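{- Let $\delta=10\in\mathbb{F}_{17}$ and let $\alpha\in\mathbb{F}_{17^2}$ be a root of $x^2-\delta$. Let $H=\{1,4,16,13\}$ and $C_{17}^E=\{0\}\cup H\cup(\alpha+7)\{1,4,16\}\cup\{4(\alpha+10)\}$. Then the setwise stabilizer of $C_{17}^E$ in $\mathrm{Aut}(P(17^2))$ is trivial, and the orbit of $C_{17}^E$ under $\mathrm{Aut}(P(17^2))$ has size $83232$.
   Context: The Paley graph $P(17^2)$ has vertex set $\mathbb{F}_{17^2}$, two distinct vertices adjacent iff their difference is a nonzero square. $\mathrm{Aut}(P(17^2))=\{\gamma\mapsto a\gamma^{v}+b : a \text{ a nonzero square of } \mathbb{F}_{17^2},\ b\in\mathbb{F}_{17^2},\ v\in\mathrm{Gal}(\mathbb{F}_{17^2})\}$, acting on subsets elementwise. Elements of $\mathbb{F}_{17}$ are written as integers mod $17$. -}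

module Defs where

open import Data.Nat as ℕ using (ℕ; zero; suc)
open import Data.Nat.DivMod using (_mod_)
open import Data.Fin as Fin using (Fin; toℕ)
import Data.Fin.Properties as FinP
open import Data.Product using (Σ; ∃; _×_; _,_; proj₁; proj₂)
import Data.Product.Properties as ProdP
open import Data.Bool using (Bool; true; false; _∧_)
open import Data.List using (List; []; _∷_; allFin; concatMap; map)
open import Data.Bool.ListAction using (any)
open import Data.Vec using (Vec; tabulate)
open import Relation.Nullary using (¬_)
open import Relation.Nullary.Decidable using (⌊_⌋)
open import Relation.Binary.PropositionalEquality using (_≡_)
open import Relation.Binary.Definitions using (DecidableEquality)

F17 : Set
F17 = Fin 17

infixl 6 _+₁₇_
infixl 7 _*₁₇_
_+₁₇_ : F17 → F17 → F17
x +₁₇ y = (toℕ x ℕ.+ toℕ y) mod 17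

_*₁₇_ : F17 → F17 → F17
x *₁₇ y = (toℕ x ℕ.* toℕ y) mod 17

k : ℕ → F17
k n = n mod 17

δ : F17
δ = k 10

-- F_{17^2} = F_17(α) with α² = δ = 10 (10 is a non-square mod 17, so x² - 10
-- is irreducible).  The pair (a , b) represents a + b α.
F : Set
F = F17 × F17

_≟F_ : DecidableEquality F
_≟F_ = ProdP.≡-dec FinP._≟_ FinP._≟_

infixl 6 _+F_
infixl 7 _*F_
_+F_ : F → F → F
(a , b) +F (c , d) = (a +₁₇ c , b +₁₇ d)

_*F_ : F → F → F
(a , b) *F (c , d) = (a *₁₇ c +₁₇ δ *₁₇ (b *₁₇ d) , a *₁₇ d +₁₇ b *₁₇ c)

0F 1F : F
0F = (k 0 , k 0)
1F = (k 1 , k 0)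

ι : F17 → F
ι x = (x , k 0)

α : F
α = (k 0 , k 1)

_^F_ : F → ℕ → F
x ^F zero = 1F
x ^F suc n = x *F (x ^F n)

IsNonzeroSquare : F → Set
IsNonzeroSquare a = ¬ (a ≡ 0F) × ∃ λ c → c *F c ≡ a

galois : Fin 2 → F → F
galois v γ = γ ^F (17 ℕ.^ toℕ v)

-- Aut(P(17^2)) : γ ↦ a γ^v + b with a a nonzero square
record Aut : Set where
  constructor aut
  field
    a   : F
    sq  : IsNonzeroSquare a
    b   : F
    v   : Fin 2

apply : Aut → F → F
apply (aut a _ b v) γ = a *F galois v γ +F b

allF : List F
allF = concatMap (λ x → map (λ y → (x , y)) (allFin 17)) (allFin 17)

SubsetF : Set
SubsetF = Vec (Vec Bool 17) 17

fromList : List F → SubsetF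
fromList xs = tabulate λ i → tabulate λ j → any (λ x → ⌊ x ≟F (i , j) ⌋) xs

member : F → SubsetF → Bool
member (i , j) S = Data.Vec.lookup (Data.Vec.lookup S i) j

image : (F → F) → SubsetF → SubsetF
image f S = tabulate λ i → tabulate λ j →
  any (λ x → member x S ∧ ⌊ f x ≟F (i , j) ⌋) allF

act : Aut → SubsetF → SubsetF
act g S = image (apply g) S

H : List F
H = ι (k 1) ∷ ι (k 4) ∷ ι (k 16) ∷ ι (k 13) ∷ []

C17E : SubsetF
C17E = fromList
  (0F ∷ H Data.List.++
    ( (α +F ι (k 7)) *F ι (k 1)
    ∷ (α +F ι (k 7)) *F ι (k 4)
    ∷ (α +F ι (k 7)) *F ι (k 16)
    ∷ ι (k 4) *F (α +F ι (k 10))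
    ∷ []))

{-# OPTIONS --safe #-}
-- Every automorphism is a semilinear affine map x ↦ a·σ(x) + b, and for fixed σ such a map
-- is determined by its values at 0 and 1.  If g(C) ⊆ h(C), pick y₀, y₁ ∈ C with h(y₀) = g(0)
-- and h(y₁) = g(1); then h⁻¹ ∘ g is the semilinear affine map sending 0, 1 to y₀, y₁, and it
-- maps C into C.  Checking the 9 · 9 · 2 candidates shows that only the identity maps C into C,
-- so g = h.  With h = id this gives the trivial stabilizer; in general g ↦ g(C) is injective,
-- so the orbit has |Aut| = 144 · 17² · 2 = 83232 elements (nonzero squares a, translations b,
-- automorphisms σ).
module Submission where

open import Defs
import Data.Nat as ℕ
open import Data.Nat.DivMod using (_mod_)
open import Data.Fin using (Fin; toℕ; zero; suc)
open import Data.Fin.Properties using (all?; any?; _≟_; *↔×)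
open import Data.Product using (Σ; ∃; _×_; _,_; proj₁; proj₂)
open import Data.Product.Function.NonDependent.Propositional using (_×-↔_)
open import Data.Sum as Sum using (_⊎_; [_,_]′)
open import Data.Bool using (Bool; T; _∧_)
open import Data.Bool.Properties using (T-∧)
open import Data.Bool.ListAction using (any; or)
open import Data.List using (List; []; _∷_; allFin; filter; length; lookup; cartesianProduct)
open import Data.List.Properties using (map-cong)
open import Data.List.Relation.Unary.All as All using (All)
open import Data.List.Relation.Unary.Any as Any using (Any; here; there; satisfied)
open import Data.List.Relation.Unary.Any.Properties using (any⁺; any⁻; lookup-index)
open import Data.List.Relation.Unary.Unique.Propositional using (Unique)
open import Data.List.Relation.Unary.AllPairs using (_∷_)
open import Data.List.Relation.Unary.Unique.Propositional.Properties using (filter⁺; cartesianProduct⁺; allFin⁺)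
open import Data.List.Membership.Propositional using (_∈_; lose)
open import Data.List.Membership.Propositional.Properties
  using (∈-allFin; ∈-cartesianProduct⁺; ∈-filter⁺; ∈-filter⁻; ∈-lookup)
open import Data.List.Membership.DecPropositional _≟F_ using (_∈?_)
open import Data.Vec using (tabulate)
import Data.Vec as Vec
open import Data.Vec.Properties using (lookup∘tabulate; tabulate-cong)
open import Function using (_∘_; id; flip; _⇔_; mk⇔; Inverse; Injection; _↔_; Equivalence)
open import Function.Properties.Inverse using (↔⇒↣)
open import Function.Construct.Composition using (_↔-∘_)
open import Function.Construct.Identity using (↔-id)
open import Function.Definitions using (Injective)
open import Level using (0ℓ)
open import Relation.Nullary using (¬_; Dec; ¬?; contradiction)
open import Relation.Nullary.Decidable
  using (from-yes; map′; _×-dec_; _⊎-dec_; _→-dec_; dec⇒maybe; toWitness; fromWitness; ⌊_⌋)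
open import Relation.Unary using (Decidable)
open import Relation.Binary.PropositionalEquality
open import Algebra.Core using (Op₁; Op₂)
open import Algebra.Bundles using (CommutativeRing)
open import Algebra.Structures using (IsCommutativeRing)
open import Algebra.Definitions using (AlmostLeftCancellative)
import Algebra.Properties.Ring as RingProperties
open import Tactic.RingSolver.Core.AlmostCommutativeRing using (fromCommutativeRing)
open import Tactic.RingSolver.Core.Expression using (Expr; Κ)
  renaming (_⊕_ to _:+_; _⊗_ to _:*_; ⊝_ to :-_)
import Tactic.RingSolver.NonReflective as NonReflective

-- The solver's _⊜_, but binding more loosely than _:+_ so that neither side needs parentheses.
infix 4 _:=_
_:=_ : ∀ {A : Set} {n} → Expr A n → Expr A n → Expr A n × Expr A n
_:=_ = _,_

∀F? : {P : F → Set} → Decidable P → Dec (∀ x → P x)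
∀F? P? = map′ (λ h z → h (proj₁ z) (proj₂ z)) (λ h x y → h (x , y)) (all? λ x → all? λ y → P? (x , y))

∃F? : {P : F → Set} → Decidable P → Dec (∃ P)
∃F? P? = map′ (λ (x , y , p) → (x , y) , p) (λ ((x , y) , p) → x , y , p) (any? λ x → any? λ y → P? (x , y))

module _ {A : Set} {_+_ _*_ : Op₂ A} { -_ : Op₁ A} {0# 1# : A} where
  open import Algebra.Definitions {A = A} _≡_
  open import Algebra.Consequences.Propositional {A = A}

  leftLaws⇒isCommutativeRing :
    Associative _+_ → Commutative _+_ → LeftIdentity 0# _+_ → LeftInverse 0# -_ _+_ →
    Associative _*_ → Commutative _*_ → LeftIdentity 1# _*_ → _*_ DistributesOverˡ _+_ →
    IsCommutativeRing _≡_ _+_ _*_ -_ 0# 1#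
  leftLaws⇒isCommutativeRing +-assoc +-comm +-identityˡ -‿inverseˡ *-assoc *-comm *-identityˡ distribˡ = record
    { isRing = record
      { +-isAbelianGroup = record
        { isGroup = record
          { isMonoid = record
            { isSemigroup = record
              { isMagma = record { isEquivalence = isEquivalence ; ∙-cong = cong₂ _+_ }
              ; assoc = +-assoc }
            ; identity = comm∧idˡ⇒id +-comm +-identityˡ }
          ; inverse = comm∧invˡ⇒inv +-comm -‿inverseˡ
          ; ⁻¹-cong = cong -_ }
        ; comm = +-comm }
      ; *-cong = cong₂ _*_
      ; *-assoc = *-assoc
      ; *-identity = comm∧idˡ⇒id *-comm *-identityˡ
      ; distrib = distribˡ , comm∧distrˡ⇒distrʳ *-comm distribˡ }
    ; *-comm = *-comm }

-₁₇_ : F17 → F17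
-₁₇ x = (17 ℕ.∸ toℕ x) mod 17

isCommutativeRing₁₇ : IsCommutativeRing _≡_ _+₁₇_ _*₁₇_ -₁₇_ (k 0) (k 1)
isCommutativeRing₁₇ = leftLaws⇒isCommutativeRing
  (from-yes (all? λ x → all? λ y → all? λ z → (x +₁₇ y) +₁₇ z ≟ x +₁₇ (y +₁₇ z)))
  (from-yes (all? λ x → all? λ y → x +₁₇ y ≟ y +₁₇ x))
  (from-yes (all? λ x → k 0 +₁₇ x ≟ x))
  (from-yes (all? λ x → -₁₇ x +₁₇ x ≟ k 0))
  (from-yes (all? λ x → all? λ y → all? λ z → (x *₁₇ y) *₁₇ z ≟ x *₁₇ (y *₁₇ z)))
  (from-yes (all? λ x → all? λ y → x *₁₇ y ≟ y *₁₇ x))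
  (from-yes (all? λ x → k 1 *₁₇ x ≟ x))
  (from-yes (all? λ x → all? λ y → all? λ z → x *₁₇ (y +₁₇ z) ≟ x *₁₇ y +₁₇ x *₁₇ z))

*₁₇-noZeroDivisors : ∀ x y → x *₁₇ y ≡ k 0 → x ≡ k 0 ⊎ y ≡ k 0
*₁₇-noZeroDivisors = from-yes (all? λ x → all? λ y → (x *₁₇ y ≟ k 0) →-dec (x ≟ k 0 ⊎-dec y ≟ k 0))

CommutativeRing₁₇ : CommutativeRing 0ℓ 0ℓ
CommutativeRing₁₇ = record { isCommutativeRing = isCommutativeRing₁₇ }

module Solver₁₇ = NonReflective (fromCommutativeRing CommutativeRing₁₇ (λ x → dec⇒maybe (k 0 ≟ x)))

infix 8 -F_
-F_ : F → F
-F (a , b) = (-₁₇ a , -₁₇ b)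

infixl 6 _-F_
_-F_ : F → F → F
x -F y = x +F -F y

conj : F → F
conj (a , b) = (a , -₁₇ b)

norm : F → F17
norm (a , b) = a *₁₇ a +₁₇ -₁₇ (δ *₁₇ (b *₁₇ b))

*F-assoc : ∀ x y z → (x *F y) *F z ≡ x *F (y *F z)
*F-assoc (a , b) (c , d) (e , f) = cong₂ _,_
  (Solver₁₇.solve 6 (λ a b c d e f →
      (a :* c :+ Κ δ :* (b :* d)) :* e :+ Κ δ :* ((a :* d :+ b :* c) :* f)
   := a :* (c :* e :+ Κ δ :* (d :* f)) :+ Κ δ :* (b :* (c :* f :+ d :* e))) refl a b c d e f)
  (Solver₁₇.solve 6 (λ a b c d e f →
      (a :* c :+ Κ δ :* (b :* d)) :* f :+ (a :* d :+ b :* c) :* e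
   := a :* (c :* f :+ d :* e) :+ b :* (c :* e :+ Κ δ :* (d :* f))) refl a b c d e f)

*F-comm : ∀ x y → x *F y ≡ y *F x
*F-comm (a , b) (c , d) = cong₂ _,_
  (Solver₁₇.solve 4 (λ a b c d → a :* c :+ Κ δ :* (b :* d) := c :* a :+ Κ δ :* (d :* b)) refl a b c d)
  (Solver₁₇.solve 4 (λ a b c d → a :* d :+ b :* c := c :* b :+ d :* a) refl a b c d)

*F-identityˡ : ∀ x → 1F *F x ≡ x
*F-identityˡ = from-yes (∀F? λ x → (1F *F x) ≟F x)

*F-distribˡ : ∀ x y z → x *F (y +F z) ≡ x *F y +F x *F z
*F-distribˡ (a , b) (c , d) (e , f) = cong₂ _,_
  (Solver₁₇.solve 6 (λ a b c d e f →
      a :* (c :+ e) :+ Κ δ :* (b :* (d :+ f))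
   := (a :* c :+ Κ δ :* (b :* d)) :+ (a :* e :+ Κ δ :* (b :* f))) refl a b c d e f)
  (Solver₁₇.solve 6 (λ a b c d e f →
      a :* (d :+ f) :+ b :* (c :+ e) := (a :* d :+ b :* c) :+ (a :* f :+ b :* e)) refl a b c d e f)

isCommutativeRingF : IsCommutativeRing _≡_ _+F_ _*F_ -F_ 0F 1F
isCommutativeRingF = leftLaws⇒isCommutativeRing
  (λ (a , b) (c , d) (e , f) → cong₂ _,_ (+-assoc a c e) (+-assoc b d f))
  (λ (a , b) (c , d) → cong₂ _,_ (+-comm a c) (+-comm b d))
  (λ (a , b) → cong₂ _,_ (+-identityˡ a) (+-identityˡ b))
  (λ (a , b) → cong₂ _,_ (-‿inverseˡ a) (-‿inverseˡ b))
  *F-assoc *F-comm *F-identityˡ *F-distribˡ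
  where
  open CommutativeRing CommutativeRing₁₇ using (+-assoc; +-comm; +-identityˡ; -‿inverseˡ)

conj-+-homo : ∀ x y → conj (x +F y) ≡ conj x +F conj y
conj-+-homo (a , b) (c , d) = cong (a +₁₇ c ,_) (Solver₁₇.solve 2 (λ b d → :- (b :+ d) := :- b :+ :- d) refl b d)

conj-*-homo : ∀ x y → conj (x *F y) ≡ conj x *F conj y
conj-*-homo (a , b) (c , d) = cong₂ _,_
  (Solver₁₇.solve 4 (λ a b c d → a :* c :+ Κ δ :* (b :* d) := a :* c :+ Κ δ :* (:- b :* :- d)) refl a b c d)
  (Solver₁₇.solve 4 (λ a b c d → :- (a :* d :+ b :* c) := a :* :- d :+ :- b :* c) refl a b c d)

conj-involutive : ∀ x → conj (conj x) ≡ x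
conj-involutive (a , b) = cong (a ,_) (Solver₁₇.solve 1 (λ b → :- (:- b) := b) refl b)

norm-*-homo : ∀ x y → norm (x *F y) ≡ norm x *₁₇ norm y
norm-*-homo (a , b) (c , d) = Solver₁₇.solve 4 (λ a b c d →
      (a :* c :+ Κ δ :* (b :* d)) :* (a :* c :+ Κ δ :* (b :* d))
        :+ :- (Κ δ :* ((a :* d :+ b :* c) :* (a :* d :+ b :* c)))
   := (a :* a :+ :- (Κ δ :* (b :* b))) :* (c :* c :+ :- (Κ δ :* (d :* d)))) refl a b c d

CommutativeRingF : CommutativeRing 0ℓ 0ℓ
CommutativeRingF = record { isCommutativeRing = isCommutativeRingF }

module SolverF = NonReflective (fromCommutativeRing CommutativeRingF (λ x → dec⇒maybe (0F ≟F x)))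

open RingProperties (CommutativeRing.ring CommutativeRingF)
  using (x[y-z]≈xy-xz; x≈y⇒x∙y⁻¹≈ε; x∙y⁻¹≈ε⇒x≈y; //-rightDividesʳ; +-cancelʳ; +-identityˡ-unique)

-- This is where δ = 10 being a non-square mod 17 enters.
norm≡0⇒≡0 : ∀ x → norm x ≡ k 0 → x ≡ 0F
norm≡0⇒≡0 = from-yes (∀F? λ x → (norm x ≟ k 0) →-dec (x ≟F 0F))

*F-noZeroDivisors : ∀ x y → x *F y ≡ 0F → x ≡ 0F ⊎ y ≡ 0F
*F-noZeroDivisors x y xy≡0 = Sum.map (norm≡0⇒≡0 x) (norm≡0⇒≡0 y)
  (*₁₇-noZeroDivisors (norm x) (norm y) (trans (sym (norm-*-homo x y)) (cong norm xy≡0)))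

*F-cancelˡ-nonZero : AlmostLeftCancellative _≡_ 0F _*F_
*F-cancelˡ-nonZero x y z x≢0 xy≡xz = [ flip contradiction x≢0 , x∙y⁻¹≈ε⇒x≈y y z ]′
  (*F-noZeroDivisors x (y -F z) (trans (x[y-z]≈xy-xz x y z) (x≈y⇒x∙y⁻¹≈ε xy≡xz)))

-- Semilinear affine maps

σ : Fin 2 → F → F
σ zero       = id
σ (suc zero) = conj

frobenius≡conj : ∀ γ → γ ^F 17 ≡ conj γ
frobenius≡conj = from-yes (∀F? λ γ → (γ ^F 17) ≟F conj γ)

galois≗σ : ∀ v γ → galois v γ ≡ σ v γ
galois≗σ zero       γ = trans (*F-comm γ 1F) (*F-identityˡ γ)
galois≗σ (suc zero) γ = frobenius≡conj γ

σ-+-homo : ∀ v x y → σ v (x +F y) ≡ σ v x +F σ v y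
σ-+-homo zero       x y = refl
σ-+-homo (suc zero) x y = conj-+-homo x y

σ-*-homo : ∀ v x y → σ v (x *F y) ≡ σ v x *F σ v y
σ-*-homo zero       x y = refl
σ-*-homo (suc zero) x y = conj-*-homo x y

σ-involutive : ∀ v x → σ v (σ v x) ≡ x
σ-involutive zero       x = refl
σ-involutive (suc zero) x = conj-involutive x

σ-injective : ∀ v {x y} → σ v x ≡ σ v y → x ≡ y
σ-injective v {x} {y} eq = trans (sym (σ-involutive v x)) (trans (cong (σ v) eq) (σ-involutive v y))

σ-0 : ∀ v → σ v 0F ≡ 0F
σ-0 zero       = refl
σ-0 (suc zero) = refl

σ-1 : ∀ v → σ v 1F ≡ 1F
σ-1 zero       = refl
σ-1 (suc zero) = refl

σ-‿homo : ∀ v x → σ v (-F x) ≡ -F σ v x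
σ-‿homo zero       x = refl
σ-‿homo (suc zero) x = refl

σ-injectiveˡ-at-α : ∀ v w → σ v α ≡ σ w α → v ≡ w
σ-injectiveˡ-at-α = from-yes (all? λ v → all? λ w → (σ v α ≟F σ w α) →-dec (v ≟ w))

infixl 6 _⊕_
_⊕_ : Fin 2 → Fin 2 → Fin 2
zero     ⊕ w        = w
suc zero ⊕ zero     = suc zero
suc zero ⊕ suc zero = zero

σ-⊕ : ∀ v w x → σ (v ⊕ w) x ≡ σ v (σ w x)
σ-⊕ zero       w          x = refl
σ-⊕ (suc zero) zero       x = refl
σ-⊕ (suc zero) (suc zero) x = sym (conj-involutive x)

affine : F → F → Fin 2 → F → F
affine a b v x = a *F σ v x +F b

affine-0 : ∀ a b v → affine a b v 0F ≡ b
affine-0 a b v rewrite σ-0 v = SolverF.solve 2 (λ a b → a :* Κ 0F :+ b := b) refl a b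

affine-1 : ∀ a b v → affine a b v 1F ≡ a +F b
affine-1 a b v rewrite σ-1 v = SolverF.solve 2 (λ a b → a :* Κ 1F :+ b := a :+ b) refl a b

affine-id : ∀ x → affine 1F 0F zero x ≡ x
affine-id = SolverF.solve 1 (λ x → Κ 1F :* x :+ Κ 0F := x) refl

affine-injective : ∀ {a} b v → ¬ a ≡ 0F → ∀ {x y} → affine a b v x ≡ affine a b v y → x ≡ y
affine-injective {a} b v a≢0 {x} {y} eq =
  σ-injective v (*F-cancelˡ-nonZero a (σ v x) (σ v y) a≢0 (+-cancelʳ b _ _ eq))

affine-cong : ∀ {a a' b b' v v'} → a ≡ a' → b ≡ b' → v ≡ v' → ∀ x → affine a b v x ≡ affine a' b' v' x
affine-cong refl refl refl x = refl

affine-≗⇒≡ : ∀ {a b v a' b' v'} → ¬ a ≡ 0F → (∀ x → affine a b v x ≡ affine a' b' v' x) →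
             a ≡ a' × b ≡ b' × v ≡ v'
affine-≗⇒≡ {a} {b} {v} {a'} {b'} {v'} a≢0 f≗g = a≡a' , b≡b' , v≡v'
  where
  b≡b' : b ≡ b'
  b≡b' = trans (sym (affine-0 a b v)) (trans (f≗g 0F) (affine-0 a' b' v'))
  a≡a' : a ≡ a'
  a≡a' = +-cancelʳ b a a'
    (trans (sym (affine-1 a b v)) (trans (f≗g 1F) (trans (affine-1 a' b' v') (cong (a' +F_) (sym b≡b')))))
  v≡v' : v ≡ v'
  v≡v' = σ-injectiveˡ-at-α v v' (*F-cancelˡ-nonZero a _ _ a≢0 (+-cancelʳ b _ _
    (trans (f≗g α) (affine-cong {v = v'} (sym a≡a') (sym b≡b') refl α))))

σ-affine : ∀ v a b x → σ v (a *F x +F b) ≡ σ v a *F σ v x +F σ v b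
σ-affine v a b x = trans (σ-+-homo v (a *F x) b) (cong (_+F σ v b) (σ-*-homo v a x))

σ-‿-homo : ∀ v x y → σ v (x -F y) ≡ σ v x -F σ v y
σ-‿-homo v x y = trans (σ-+-homo v x (-F y)) (cong (σ v x +F_) (σ-‿homo v y))

-- The hypotheses say h y₀ = g 0 and h y₁ = g 1; the inner map is h⁻¹ ∘ g.
affine-factor : ∀ {ag bg vg ah bh vh y₀ y₁} →
                affine ah bh vh y₀ ≡ bg → affine ah bh vh y₁ ≡ ag +F bg →
                ∀ x → affine ah bh vh (affine (y₁ -F y₀) y₀ (vh ⊕ vg) x) ≡ affine ag bg vg x
affine-factor {ag} {bg} {vg} {ah} {bh} {vh} {y₀} {y₁} e₀ e₁ x = begin
  ah *F σ vh ((y₁ -F y₀) *F σ (vh ⊕ vg) x +F y₀) +F bh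
    ≡⟨ cong (λ t → ah *F t +F bh) (σ-affine vh (y₁ -F y₀) y₀ (σ (vh ⊕ vg) x)) ⟩
  ah *F (σ vh (y₁ -F y₀) *F σ vh (σ (vh ⊕ vg) x) +F Y₀) +F bh
    ≡⟨ cong₂ (λ p q → ah *F (p *F q +F Y₀) +F bh) (σ-‿-homo vh y₁ y₀) σ-twist ⟩
  ah *F ((Y₁ -F Y₀) *F X +F Y₀) +F bh
    ≡⟨ SolverF.solve 5 (λ ah Y₀ Y₁ X bh →
         ah :* ((Y₁ :+ :- Y₀) :* X :+ Y₀) :+ bh
      := ((ah :* Y₁ :+ bh) :+ :- (ah :* Y₀ :+ bh)) :* X :+ (ah :* Y₀ :+ bh)) refl ah Y₀ Y₁ X bh ⟩
  ((ah *F Y₁ +F bh) -F (ah *F Y₀ +F bh)) *F X +F (ah *F Y₀ +F bh)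
    ≡⟨ cong₂ (λ p q → (p -F q) *F X +F q) e₁ e₀ ⟩
  ((ag +F bg) -F bg) *F X +F bg
    ≡⟨ cong (λ p → p *F X +F bg) (//-rightDividesʳ bg ag) ⟩
  ag *F X +F bg ∎
  where
  open ≡-Reasoning
  Y₀ = σ vh y₀
  Y₁ = σ vh y₁
  X  = σ vg x
  σ-twist : σ vh (σ (vh ⊕ vg) x) ≡ X
  σ-twist = trans (cong (σ vh) (σ-⊕ vh vg x)) (σ-involutive vh X)

-- Rigidity of C

-- The last four points are (α+7)·1, (α+7)·4, (α+7)·16 and 4(α+10), written as a + bα.
C-points : List F
C-points = 0F ∷ 1F ∷ ι (k 4) ∷ ι (k 16) ∷ ι (k 13) ∷ (k 7 , k 1) ∷ (k 11 , k 4) ∷ (k 10 , k 16) ∷ (k 6 , k 4) ∷ []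

C17E≡fromList : C17E ≡ fromList C-points
C17E≡fromList = refl

IntoC : (F → F) → Set
IntoC f = All (λ x → f x ∈ C-points) C-points

Rigid : F → F → Fin 2 → Set
Rigid a b v = ¬ a ≡ 0F → IntoC (affine a b v) → a ≡ 1F × b ≡ 0F × v ≡ zero

rigid? : ∀ a b v → Dec (Rigid a b v)
rigid? a b v = ¬? (a ≟F 0F) →-dec All.all? (λ x → affine a b v x ∈? C-points) C-points
  →-dec (a ≟F 1F ×-dec b ≟F 0F ×-dec v ≟ zero)

-- An affine map f is determined by f 0 = b and f 1 = a + b, so it suffices to try b, a + b ∈ C.
C-rigidity : All (λ b → All (λ c → ∀ v → Rigid (c -F b) b v) C-points) C-points
C-rigidity = from-yes (All.all? (λ b → All.all? (λ c → all? (rigid? (c -F b) b)) C-points) C-points)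

affine-into-C⇒id : ∀ {a b v} → ¬ a ≡ 0F → IntoC (affine a b v) → a ≡ 1F × b ≡ 0F × v ≡ zero
affine-into-C⇒id {a} {b} {v} a≢0 into =
  subst (λ a → Rigid a b v) (//-rightDividesʳ b a) (All.lookup (All.lookup C-rigidity b∈C) a+b∈C v) a≢0 into
  where
  b∈C : b ∈ C-points
  b∈C = subst (_∈ C-points) (affine-0 a b v) (All.lookup into (here refl))
  a+b∈C : a +F b ∈ C-points
  a+b∈C = subst (_∈ C-points) (affine-1 a b v) (All.lookup into (there (here refl)))

affine-image-C-⊆⇒≡ : ∀ {ag bg vg ah bh vh} → ¬ ag ≡ 0F → ¬ ah ≡ 0F →
  (∀ {x} → x ∈ C-points → ∃ λ z → z ∈ C-points × affine ah bh vh z ≡ affine ag bg vg x) →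
  ag ≡ ah × bg ≡ bh × vg ≡ vh
affine-image-C-⊆⇒≡ {ag} {bg} {vg} {ah} {bh} {vh} ag≢0 ah≢0 cover = affine-≗⇒≡ ag≢0 (λ x → sym (h≗g x))
  where
  g h : F → F
  g = affine ag bg vg
  h = affine ah bh vh
  y₀ y₁ : F
  y₀ = proj₁ (cover (here refl))
  y₁ = proj₁ (cover (there (here refl)))
  e₀ : h y₀ ≡ bg
  e₀ = trans (proj₂ (proj₂ (cover (here refl)))) (affine-0 ag bg vg)
  e₁ : h y₁ ≡ ag +F bg
  e₁ = trans (proj₂ (proj₂ (cover (there (here refl))))) (affine-1 ag bg vg)
  κ : F → F
  κ = affine (y₁ -F y₀) y₀ (vh ⊕ vg)
  factor : ∀ x → h (κ x) ≡ g x
  factor = affine-factor {ag} {bg} {vg} {ah} {bh} {vh} e₀ e₁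
  κ-into-C : IntoC κ
  κ-into-C = All.tabulate λ {x} x∈C →
    let (z , z∈C , hz≡gx) = cover x∈C
    in subst (_∈ C-points) (affine-injective bh vh ah≢0 (trans hz≡gx (sym (factor x)))) z∈C
  y₁-y₀≢0 : ¬ y₁ -F y₀ ≡ 0F
  y₁-y₀≢0 y₁-y₀≡0 = ag≢0 (+-identityˡ-unique ag bg
    (trans (sym e₁) (trans (cong h (x∙y⁻¹≈ε⇒x≈y y₁ y₀ y₁-y₀≡0)) e₀)))
  κ≗id : ∀ x → κ x ≡ x
  κ≗id x = let (a≡1 , b≡0 , v≡0) = affine-into-C⇒id y₁-y₀≢0 κ-into-C
           in trans (affine-cong {v = vh ⊕ vg} a≡1 b≡0 v≡0 x) (affine-id x)
  h≗g : ∀ x → h x ≡ g x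
  h≗g x = trans (cong h (sym (κ≗id x))) (factor x)

member-tabulate : ∀ (p : F → Bool) y → member y (tabulate λ i → tabulate λ j → p (i , j)) ≡ p y
member-tabulate p (i , j) =
  trans (cong (λ r → Vec.lookup r j) (lookup∘tabulate (λ i → tabulate λ j → p (i , j)) i)) (lookup∘tabulate (λ j → p (i , j)) j)

allF≡cartesianProduct : allF ≡ cartesianProduct (allFin 17) (allFin 17)
allF≡cartesianProduct = refl

∈-allF : ∀ x → x ∈ allF
∈-allF (i , j) = subst ((i , j) ∈_) (sym allF≡cartesianProduct) (∈-cartesianProduct⁺ (∈-allFin i) (∈-allFin j))

allF-unique : Unique allF
allF-unique = subst Unique (sym allF≡cartesianProduct) (cartesianProduct⁺ (allFin⁺ 17) (allFin⁺ 17))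

∈-fromList⁺ : ∀ {xs y} → y ∈ xs → T (member y (fromList xs))
∈-fromList⁺ {xs} {y} y∈xs = subst T (sym (member-tabulate (λ y → any (λ x → ⌊ x ≟F y ⌋) xs) y))
  (any⁺ (λ x → ⌊ x ≟F y ⌋) (Any.map (λ y≡x → fromWitness (sym y≡x)) y∈xs))

∈-fromList⁻ : ∀ {xs y} → T (member y (fromList xs)) → y ∈ xs
∈-fromList⁻ {xs} {y} y∈S = Any.map (λ x≟y → sym (toWitness x≟y))
  (any⁻ (λ x → ⌊ x ≟F y ⌋) xs (subst T (member-tabulate (λ y → any (λ x → ⌊ x ≟F y ⌋) xs) y) y∈S))

module _ (f : F → F) (S : SubsetF) where

  private
    hits : F → F → Bool
    hits y x = member x S ∧ ⌊ f x ≟F y ⌋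

  ∈-image⁺ : ∀ {x} → T (member x S) → T (member (f x) (image f S))
  ∈-image⁺ {x} x∈S = subst T (sym (member-tabulate (λ y → any (hits y) allF) (f x)))
    (any⁺ (hits (f x)) (lose (∈-allF x) (Equivalence.from T-∧ (x∈S , fromWitness {a? = f x ≟F f x} refl))))

  ∈-image⁻ : ∀ {y} → T (member y (image f S)) → ∃ λ x → T (member x S) × f x ≡ y
  ∈-image⁻ {y} y∈fS =
    let (x , hit) = satisfied (any⁻ (hits y) allF (subst T (member-tabulate (λ y → any (hits y) allF) y) y∈fS))
        (x∈S , fx≟y) = Equivalence.to (T-∧ {member x S}) hit
    in x , x∈S , toWitness fx≟y

∈-C⁺ : ∀ {x} → x ∈ C-points → T (member x C17E)
∈-C⁺ {x} x∈C = subst (T ∘ member x) (sym C17E≡fromList) (∈-fromList⁺ x∈C)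

∈-C⁻ : ∀ {x} → T (member x C17E) → x ∈ C-points
∈-C⁻ {x} x∈C = ∈-fromList⁻ (subst (T ∘ member x) C17E≡fromList x∈C)

image-cong : ∀ {f g : F → F} → (∀ x → f x ≡ g x) → ∀ S → image f S ≡ image g S
image-cong f≗g S = tabulate-cong λ i → tabulate-cong λ j →
  cong or (map-cong (λ x → cong (λ y → member x S ∧ ⌊ y ≟F (i , j) ⌋) (f≗g x)) allF)

Unique⇒lookup-injective : ∀ {A : Set} {xs : List A} → Unique xs → Injective _≡_ _≡_ (lookup xs)
Unique⇒lookup-injective {xs = _ ∷ _} (x∉xs ∷ _) {zero}  {zero}  _  = refl
Unique⇒lookup-injective {xs = _ ∷ _} (x∉xs ∷ _) {zero}  {suc j} eq = contradiction eq (All.lookup x∉xs (∈-lookup j))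
Unique⇒lookup-injective {xs = _ ∷ _} (x∉xs ∷ _) {suc i} {zero}  eq = contradiction (sym eq) (All.lookup x∉xs (∈-lookup i))
Unique⇒lookup-injective {xs = _ ∷ _} (_ ∷ xs!)  {suc i} {suc j} eq = cong suc (Unique⇒lookup-injective xs! eq)

apply≗affine : ∀ g γ → apply g γ ≡ affine (Aut.a g) (Aut.b g) (Aut.v g) γ
apply≗affine (aut a _ b v) γ = cong (λ t → a *F t +F b) (galois≗σ v γ)

Aut-a≢0 : ∀ g → ¬ Aut.a g ≡ 0F
Aut-a≢0 g = proj₁ (Aut.sq g)

stabilizer-trivial : ∀ g → act g C17E ≡ C17E → ∀ γ → apply g γ ≡ γ
stabilizer-trivial g gC≡C γ =
  let (a≡1 , b≡0 , v≡0) = affine-into-C⇒id (Aut-a≢0 g) (All.tabulate into)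
  in trans (apply≗affine g γ) (trans (affine-cong {v = Aut.v g} a≡1 b≡0 v≡0 γ) (affine-id γ))
  where
  into : ∀ {x} → x ∈ C-points → affine (Aut.a g) (Aut.b g) (Aut.v g) x ∈ C-points
  into {x} x∈C = subst (_∈ C-points) (apply≗affine g x)
    (∈-C⁻ (subst (T ∘ member (apply g x)) gC≡C (∈-image⁺ (apply g) C17E (∈-C⁺ x∈C))))

act-C-injective : ∀ g h → act g C17E ≡ act h C17E →
                  Aut.a g ≡ Aut.a h × Aut.b g ≡ Aut.b h × Aut.v g ≡ Aut.v h
act-C-injective g h gC≡hC = affine-image-C-⊆⇒≡ (Aut-a≢0 g) (Aut-a≢0 h) cover
  where
  cover : ∀ {x} → x ∈ C-points →
          ∃ λ z → z ∈ C-points × affine (Aut.a h) (Aut.b h) (Aut.v h) z ≡ affine (Aut.a g) (Aut.b g) (Aut.v g) x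
  cover {x} x∈C =
    let (z , z∈C , hz≡gx) = ∈-image⁻ (apply h) C17E
                              (subst (T ∘ member (apply g x)) gC≡hC (∈-image⁺ (apply g) C17E (∈-C⁺ x∈C)))
    in z , ∈-C⁻ z∈C , trans (sym (apply≗affine h z)) (trans hz≡gx (apply≗affine g x))

-- Enumerating Aut

NormIsSquare : F → Set
NormIsSquare a = ¬ a ≡ 0F × ∃ λ m → m *₁₇ m ≡ norm a

normIsSquare? : Decidable NormIsSquare
normIsSquare? a = ¬? (a ≟F 0F) ×-dec any? (λ m → m *₁₇ m ≟ norm a)

NormIsSquare⇒IsNonzeroSquare : ∀ a → NormIsSquare a → IsNonzeroSquare a
NormIsSquare⇒IsNonzeroSquare =
  from-yes (∀F? λ a → normIsSquare? a →-dec (¬? (a ≟F 0F) ×-dec ∃F? λ c → (c *F c) ≟F a))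

IsNonzeroSquare⇒NormIsSquare : ∀ a → IsNonzeroSquare a → NormIsSquare a
IsNonzeroSquare⇒NormIsSquare a (a≢0 , c , refl) = a≢0 , norm c , sym (norm-*-homo c c)

-- A nonzero a is a square iff its norm is a square in F₁₇; testing that instead of searching
-- for a root keeps nonzeroSquares cheap to compute.
isNonzeroSquare? : Decidable IsNonzeroSquare
isNonzeroSquare? a = map′ (NormIsSquare⇒IsNonzeroSquare a) (IsNonzeroSquare⇒NormIsSquare a) (normIsSquare? a)

nonzeroSquares : List F
nonzeroSquares = filter isNonzeroSquare? allF

square : Fin (length nonzeroSquares) → F
square = lookup nonzeroSquares

square-isNonzeroSquare : ∀ i → IsNonzeroSquare (square i)
square-isNonzeroSquare i = proj₂ (∈-filter⁻ isNonzeroSquare? {xs = allF} (∈-lookup {xs = nonzeroSquares} i))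

square-injective : Injective _≡_ _≡_ square
square-injective = Unique⇒lookup-injective (filter⁺ isNonzeroSquare? allF-unique)

square-surjective : ∀ {a} → IsNonzeroSquare a → ∃ λ i → square i ≡ a
square-surjective {a} a-sq = Any.index {xs = nonzeroSquares} a∈ , sym (lookup-index {xs = nonzeroSquares} a∈)
  where
  a∈ : a ∈ nonzeroSquares
  a∈ = ∈-filter⁺ isNonzeroSquare? {xs = allF} (∈-allF a) a-sq

Parameters : Set
Parameters = Fin (length nonzeroSquares) × F × Fin 2

-- This type-checks because nonzeroSquares has 144 elements, and 83232 = 144 · 17² · 2.
parameters : Fin 83232 ↔ Parameters
parameters = (↔-id _ ×-↔ (*↔× {17} {17} ×-↔ ↔-id (Fin 2)))
         ↔-∘ ((↔-id _ ×-↔ *↔× {289} {2}) ↔-∘ *↔× {length nonzeroSquares} {578})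

autOf : Parameters → Aut
autOf (i , b , v) = aut (square i) (square-isNonzeroSquare i) b v

act-autOf-cong : ∀ p q → p ≡ q → ∀ S → act (autOf p) S ≡ act (autOf q) S
act-autOf-cong p .p refl S = refl

act-autOf : ∀ i b v a (a-sq : IsNonzeroSquare a) → square i ≡ a → ∀ S →
            act (autOf (i , b , v)) S ≡ act (aut a a-sq b v) S
act-autOf i b v a a-sq refl = image-cong {apply (autOf (i , b , v))} {apply (aut a a-sq b v)} (λ _ → refl)

autOf-complete : ∀ g → ∃ λ p → ∀ S → act (autOf p) S ≡ act g S
autOf-complete (aut a a-sq b v) = (i , b , v) , act-autOf i b v a a-sq (proj₂ (square-surjective a-sq))
  where
  i : Fin (length nonzeroSquares)
  i = proj₁ (square-surjective a-sq)

autOf-injective-on-C : ∀ p q → act (autOf p) C17E ≡ act (autOf q) C17E → p ≡ q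
autOf-injective-on-C (i , b , v) (j , b' , v') eq =
  let (i≡j , b≡b' , v≡v') = act-C-injective (autOf (i , b , v)) (autOf (j , b' , v')) eq
  in cong₂ _,_ (square-injective i≡j) (cong₂ _,_ b≡b' v≡v')

orbitElement : Fin 83232 → SubsetF
orbitElement n = act (autOf (Inverse.to parameters n)) C17E

orbitElement-injective : Injective _≡_ _≡_ orbitElement
orbitElement-injective {m} {n} eq = Injection.injective (↔⇒↣ parameters)
  (autOf-injective-on-C (Inverse.to parameters m) (Inverse.to parameters n) eq)

orbit-enumerated : ∀ S → (∃ λ g → act g C17E ≡ S) ⇔ (∃ λ n → orbitElement n ≡ S)
orbit-enumerated S = mk⇔ (λ (g , gC≡S) → enumerate g gC≡S (autOf-complete g))
                         (λ (n , eq) → autOf (Inverse.to parameters n) , eq)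
  where
  enumerate : ∀ g → act g C17E ≡ S → (∃ λ p → ∀ S → act (autOf p) S ≡ act g S) → ∃ λ n → orbitElement n ≡ S
  enumerate g gC≡S (p , same-action) = Inverse.from parameters p ,
    trans (act-autOf-cong (Inverse.to parameters (Inverse.from parameters p)) p
                          (Inverse.strictlyInverseˡ parameters p) C17E)
          (trans (same-action C17E) gC≡S)

-- Passing m and n explicitly stops Agda from unifying orbitElement ?m with orbitElement m by
-- unfolding both images.
lemma3p15 : ((g : Aut) → act g C17E ≡ C17E → (γ : F) → apply g γ ≡ γ)
    × (Σ (Fin 83232 → SubsetF) λ e → Injective _≡_ _≡_ e
         × ((S : SubsetF) → (∃ λ g → act g C17E ≡ S) ⇔ (∃ λ i → e i ≡ S)))
lemma3p15 = stabilizer-trivial , orbitElement , (λ {m} {n} → orbitElement-injective {m} {n}) , orbit-enumerated
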